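{- For every positive integer $n$, every outerplanar graph that contains every outerplanar graph on $n$ vertices as a subgraph has at least $\sqrt{2}^{\,n-5}$ vertices.
   Context: Contained as a subgraph means there is an injective map of vertices sending edges to edges. -}

module Defs where

open import Data.Nat using (ℕ; _<_)
open import Data.Fin using (Fin; toℕ)
open import Data.Bool using (Bool; true; false)
open import Data.Product using (Σ; _×_)
open import Data.Empty using (⊥)
open import Relation.Binary.PropositionalEquality using (_≡_)
open import Function.Definitions using (Injective)
open import Function.Bundles using (_↔_; Inverse)

record Graph (m : ℕ) : Set where
  field
    adj   : Fin m → Fin m → Bool
    sym   : ∀ u v → adj u v ≡ adj v u
    irrefl : ∀ v → adj v v ≡ false

open Graph public

Edge : ∀ {m} → Graph m → Fin m → Fin m → Set
Edge G u v = adj G u v ≡ true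

-- Outerplanar: the vertices can be placed in a cyclic order (here: a
-- bijection pos onto positions 0..m-1 around a circle) so that all
-- edges, drawn as straight chords, are pairwise non-crossing.  Two
-- chords {a,b} and {c,d} cross iff pos a < pos c < pos b < pos d
-- (up to renaming the endpoints).
Outerplanar : ∀ {m} → Graph m → Set
Outerplanar {m} G =
  Σ (Fin m ↔ Fin m) λ pos →
    ∀ a b c d →
      toℕ (Inverse.to pos a) < toℕ (Inverse.to pos c) →
      toℕ (Inverse.to pos c) < toℕ (Inverse.to pos b) →
      toℕ (Inverse.to pos b) < toℕ (Inverse.to pos d) →
      Edge G a b → Edge G c d → ⊥

_⊆G_ : ∀ {n m} → Graph n → Graph m → Set
_⊆G_ {n} {m} G H =
  Σ (Fin n → Fin m) λ f →
    Injective _≡_ _≡_ f × (∀ u v → Edge G u v → Edge H (f u) (f v))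

module Submission where

-- For a bit string d of length n − 5, the zigzag graph on 0, 1, …, n − 1 is the
-- polygon triangulated by a strip of triangles: first 0 1 (n − 1), then on the
-- current chord lo hi the triangle with apex lo + 1 or hi − 1 according to the
-- next bit of false ∷ d, ending with an apex Z. It is outerplanar, so it embeds
-- into H; draw H with the image A of 0 first on its circle. In an outerplanar
-- drawing a chord has at most one common neighbour of its ends on each side, and
-- no neighbour of A lies strictly inside a chord between two neighbours of A.
-- Hence the image of Z determines the first chord of the strip and then each of
-- its steps, so distinct codes d give distinct pairs (image of 0, image of Z).

open import Defs
open import Data.Bool using (Bool; true; false; not)
open import Data.Bool.Properties using (∨-comm; not-injective)
open import Data.Empty using (⊥; ⊥-elim)
open import Data.Fin using (Fin; zero; suc; toℕ; fromℕ<; combine; quotient; remainder)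
open import Data.Fin.Properties using (toℕ-injective; toℕ-fromℕ<; toℕ<n; injective⇒≤; combine-injective; combine-remQuot; 2↔Bool)
open import Data.List using (List; []; _∷_)
open import Data.List.Membership.Propositional using (_∈_)
open import Data.List.Relation.Binary.Subset.Propositional using (_⊆_)
open import Data.List.Relation.Binary.Subset.Propositional.Properties using (⊆-refl)
open import Data.List.Relation.Unary.Any using (here; there)
open import Data.Nat using (ℕ; zero; suc; pred; _+_; _*_; _^_; _∸_; _≤_; _<_; z≤n; s≤s; _≟_; _≤?_; _<?_)
open import Data.Nat.Properties using (≤-refl; ≤-trans; <-trans; <-irrefl; <-asym; <-cmp; <⇒≤; <⇒≱; n≮0; n<1+n; n≤1+n; m<n⇒m<1+n; m<1+n⇒m≤n; m≤n⇒m≤1+n; m≤n+m; n≢0⇒n>0; pred[n]≤n; +-suc; +-comm; m⊓n≤n; m≤n⇒m⊓n≡m)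
open import Data.Product using (Σ-syntax; _×_; _,_; proj₁; proj₂; swap)
open import Data.Product.Properties using (≡-dec)
open import Data.Sum using (_⊎_; inj₁; inj₂; [_,_])
open import Data.Vec using (Vec; []; _∷_; map)
open import Data.Vec.Properties using (∷-injectiveˡ; ∷-injectiveʳ)
open import Function using (_∘_)
open import Function.Bundles using (Inverse; Injection)
open import Function.Construct.Identity using (↔-id)
open import Function.Definitions using (Injective)
open import Function.Properties.Inverse using (↔⇒↣)
open import Relation.Binary using (tri<; tri≈; tri>)
open import Relation.Binary.PropositionalEquality using (_≡_; _≢_; refl; trans; cong; cong₂; subst; subst₂; module ≡-Reasoning) renaming (sym to ≡-sym)
open import Relation.Nullary using (Dec; yes; does; ¬_; contradiction; _×-dec_; _⊎-dec_)
open import Relation.Nullary.Decidable using (dec-true; dec-false)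
open import Data.List.Membership.DecPropositional (≡-dec _≟_ _≟_) using (_∈?_)

map-injective : ∀ {A B : Set} {f : A → B} {n} → Injective _≡_ _≡_ f → Injective _≡_ _≡_ (map {n = n} f)
map-injective f-injective {[]}    {[]}    _ = refl
map-injective f-injective {_ ∷ _} {_ ∷ _} e =
  cong₂ _∷_ (f-injective (∷-injectiveˡ e)) (map-injective f-injective (∷-injectiveʳ e))

does-true : ∀ {A : Set} (a? : Dec A) → does a? ≡ true → A
does-true (yes a) _ = a

module _ {m : ℕ} (G : Graph m) where

  edge-sym : ∀ {u v} → Edge G u v → Edge G v u
  edge-sym {u} {v} e = trans (Graph.sym G v u) e

  edge-≢ : ∀ {u v} → Edge G u v → u ≢ v
  edge-≢ {u} e refl = contradiction (trans (≡-sym e) (irrefl G u)) λ ()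

  Triangle : Fin m → Fin m → Fin m → Set
  Triangle a b c = Edge G a b × Edge G a c × Edge G b c

  triangle-swap : ∀ {a b c} → Triangle a b c → Triangle a c b
  triangle-swap (ab , ac , bc) = ac , ab , edge-sym bc

  Apex : Fin m → Fin m → Fin m → Fin m → Set
  Apex x y p w = Edge G x w × Edge G y w × w ≢ p

  apex-swap : ∀ {x y p w} → Apex x y p w → Apex y x p w
  apex-swap (xw , yw , w≢p) = yw , xw , w≢p

  Strip : ∀ {j} → Fin m → Fin m → Fin m → Vec Bool j → Fin m → Set
  Strip x y p []          z = Apex x y p z
  Strip x y p (true ∷ s)  z = Σ[ w ∈ Fin m ] Apex x y p w × Strip w y x s z
  Strip x y p (false ∷ s) z = Σ[ w ∈ Fin m ] Apex x y p w × Strip x w y s z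

  strip-swap : ∀ {j x y p z} (s : Vec Bool j) → Strip x y p s z → Strip y x p (map not s) z
  strip-swap []          a              = apex-swap a
  strip-swap (true ∷ s)  (w , a , rest) = w , apex-swap a , strip-swap s rest
  strip-swap (false ∷ s) (w , a , rest) = w , apex-swap a , strip-swap s rest

module _ {n m : ℕ} {G : Graph n} {H : Graph m} (e : G ⊆G H) where
  private
    f : Fin n → Fin m
    f = proj₁ e
    f-injective : Injective _≡_ _≡_ f
    f-injective = proj₁ (proj₂ e)
    f-edge : ∀ u v → Edge G u v → Edge H (f u) (f v)
    f-edge = proj₂ (proj₂ e)

  triangle-map : ∀ {a b c} → Triangle G a b c → Triangle H (f a) (f b) (f c)
  triangle-map (ab , ac , bc) = f-edge _ _ ab , f-edge _ _ ac , f-edge _ _ bc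

  apex-map : ∀ {x y p w} → Apex G x y p w → Apex H (f x) (f y) (f p) (f w)
  apex-map (xw , yw , w≢p) = f-edge _ _ xw , f-edge _ _ yw , w≢p ∘ f-injective

  strip-map : ∀ {j x y p z} (s : Vec Bool j) → Strip G x y p s z → Strip H (f x) (f y) (f p) s (f z)
  strip-map []          a              = apex-map a
  strip-map (true ∷ s)  (w , a , rest) = f w , apex-map a , strip-map s rest
  strip-map (false ∷ s) (w , a , rest) = f w , apex-map a , strip-map s rest

NonCrossing : ∀ {m} → Graph m → (Fin m → ℕ) → Set
NonCrossing H pos =
  ∀ a b c d → pos a < pos c → pos c < pos b → pos b < pos d → Edge H a b → Edge H c d → ⊥

record Drawing {m : ℕ} (H : Graph m) : Set where
  field
    pos           : Fin m → ℕ
    pos<m         : ∀ v → pos v < m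
    pos-injective : Injective _≡_ _≡_ pos
    nonCrossing   : NonCrossing H pos

outerplanar-drawing : ∀ {m} {H : Graph m} → Outerplanar H → Drawing H
outerplanar-drawing (π , nonCrossing) = record
  { pos           = toℕ ∘ Inverse.to π
  ; pos<m         = toℕ<n ∘ Inverse.to π
  ; pos-injective = Injection.injective (↔⇒↣ π) ∘ toℕ-injective
  ; nonCrossing   = nonCrossing
  }

predMod : ℕ → ℕ → ℕ
predMod m zero    = pred m
predMod m (suc q) = q

predMod-< : ∀ {m q} → q < m → predMod m q < m
predMod-< {suc m} {zero}  _         = n<1+n m
predMod-< {suc m} {suc q} (s≤s q<m) = m<n⇒m<1+n q<m

predMod-injective : ∀ {m a b} → a < m → b < m → predMod m a ≡ predMod m b → a ≡ b
predMod-injective {suc m} {zero}  {zero}  _         _         _   = refl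
predMod-injective {suc m} {zero}  {suc b} _         (s≤s b<m) m≡b = contradiction b<m (<-irrefl (≡-sym m≡b))
predMod-injective {suc m} {suc a} {zero}  (s≤s a<m) _         a≡m = contradiction a<m (<-irrefl a≡m)
predMod-injective {suc m} {suc a} {suc b} _         _         a≡b = cong suc a≡b

predMod-order : ∀ {m a b} → b < m → predMod m a < predMod m b → 0 < a × (a < b ⊎ b ≡ 0)
predMod-order {suc m} {zero}  b<m     m<b = contradiction (m<1+n⇒m≤n (predMod-< b<m)) (<⇒≱ m<b)
predMod-order {suc m} {suc a} {zero}  _ _   = s≤s z≤n , inj₂ refl
predMod-order {suc m} {suc a} {suc b} _ a<b = s≤s z≤n , inj₁ (s≤s a<b)

rotate : ∀ {m} {H : Graph m} → Drawing H → Drawing H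
rotate {m} {H} D = record
  { pos           = predMod m ∘ pos
  ; pos<m         = predMod-< ∘ pos<m
  ; pos-injective = λ e → pos-injective (predMod-injective (pos<m _) (pos<m _) e)
  ; nonCrossing   = nonCrossing′
  }
  where
  open Drawing D

  nonCrossing′ : NonCrossing H (predMod m ∘ pos)
  nonCrossing′ a b c d ac cb bd ab cd
    with predMod-order (pos<m c) ac | predMod-order (pos<m b) cb | predMod-order (pos<m d) bd
  ... | _   , inj₁ a<c | _   , inj₁ c<b | _ , inj₁ b<d = nonCrossing a b c d a<c c<b b<d ab cd
  ... | 0<a , inj₁ a<c | _   , inj₁ c<b | _ , inj₂ d≡0 =
    -- d has wrapped around from the front: originally d < a < c < b
    nonCrossing d c a b (subst (_< pos a) (≡-sym d≡0) 0<a) a<c c<b (edge-sym H cd) ab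
  ... | _   , inj₂ c≡0 | 0<c , _        | _            = <-irrefl (≡-sym c≡0) 0<c
  ... | _   , _        | _   , inj₂ b≡0 | 0<b , _      = <-irrefl (≡-sym b≡0) 0<b

rotate-to-zero : ∀ {m} {H : Graph m} → Drawing H → (A : Fin m) → Σ[ D ∈ Drawing H ] Drawing.pos D A ≡ 0
rotate-to-zero {H = H} D A = go (Drawing.pos D A) D refl
  where
  go : ∀ q (D : Drawing H) → Drawing.pos D A ≡ q → Σ[ D′ ∈ Drawing H ] Drawing.pos D′ A ≡ 0
  go zero    D A-at-0 = D , A-at-0
  go (suc q) D A-at-q = go q (rotate D) (cong (predMod _) A-at-q)

module Geometry {m : ℕ} {H : Graph m} (D : Drawing H) where
  open Drawing D

  Inside : Fin m → Fin m → Fin m → Set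
  Inside x y q = pos x < pos q × pos q < pos y

  Outside : Fin m → Fin m → Fin m → Set
  Outside x y q = pos q < pos x ⊎ pos y < pos q

  Between : Fin m → Fin m → Fin m → Set
  Between x y q = Inside x y q ⊎ Inside y x q

  edge-across : ∀ {x y q r} → Edge H x y → Edge H q r → Inside x y q → Outside x y r → ⊥
  edge-across {x} {y} {q} {r} xy qr (x<q , q<y) (inj₁ r<x) = nonCrossing r q x y r<x x<q q<y (edge-sym H qr) xy
  edge-across {x} {y} {q} {r} xy qr (x<q , q<y) (inj₂ y<r) = nonCrossing x y q r x<q q<y y<r xy qr

  inside-or-outside : ∀ {x y q} → q ≢ x → q ≢ y → Inside x y q ⊎ Outside x y q
  inside-or-outside {x} {y} {q} q≢x q≢y with <-cmp (pos q) (pos x) | <-cmp (pos q) (pos y)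
  ... | tri≈ _ q≡x _ | _              = contradiction (pos-injective q≡x) q≢x
  ... | _            | tri≈ _ q≡y _   = contradiction (pos-injective q≡y) q≢y
  ... | tri< q<x _ _ | _              = inj₂ (inj₁ q<x)
  ... | _            | tri> _ _ y<q   = inj₂ (inj₂ y<q)
  ... | tri> _ _ x<q | tri< q<y _ _   = inj₁ (x<q , q<y)

  common-neighbours-inside : ∀ {x y w w′} → Inside x y w → Inside x y w′ →
    Edge H x w → Edge H y w → Edge H x w′ → Edge H y w′ → w ≡ w′
  common-neighbours-inside {x} {y} {w} {w′} (x<w , w<y) (x<w′ , w′<y) xw yw xw′ yw′
    with <-cmp (pos w) (pos w′)
  ... | tri< w<w′ _ _ = ⊥-elim (nonCrossing x w′ w y x<w w<w′ w′<y xw′ (edge-sym H yw))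
  ... | tri≈ _ w≡w′ _ = pos-injective w≡w′
  ... | tri> _ _ w′<w = ⊥-elim (nonCrossing x w w′ y x<w′ w′<w w<y xw (edge-sym H yw′))

  outside-neighbours-unordered : ∀ {x y w w′} → pos x < pos y → Outside x y w → Outside x y w′ →
    Edge H x w → Edge H y w → Edge H x w′ → Edge H y w′ → pos w < pos w′ → ⊥
  outside-neighbours-unordered {x} {y} x<y (inj₁ w<x) (inj₁ w′<x) xw _  _   yw′ w<w′ =
    nonCrossing _ x _ y w<w′ w′<x x<y (edge-sym H xw) (edge-sym H yw′)
  outside-neighbours-unordered {x} {y} x<y (inj₁ w<x) (inj₂ y<w′) _  yw xw′ _   _    =
    nonCrossing _ y x _ w<x x<y y<w′ (edge-sym H yw) xw′
  outside-neighbours-unordered x<y (inj₂ y<w) (inj₁ w′<x) _ _ _ _ w<w′ =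
    <-asym w<w′ (<-trans w′<x (<-trans x<y y<w))
  outside-neighbours-unordered {x} {y} x<y (inj₂ y<w) (inj₂ y<w′) xw _  _   yw′ w<w′ =
    nonCrossing x _ y _ x<y y<w w<w′ xw yw′

  common-neighbours-outside : ∀ {x y w w′} → pos x < pos y → Outside x y w → Outside x y w′ →
    Edge H x w → Edge H y w → Edge H x w′ → Edge H y w′ → w ≡ w′
  common-neighbours-outside {w = w} {w′} x<y out out′ xw yw xw′ yw′ with <-cmp (pos w) (pos w′)
  ... | tri< w<w′ _ _ = ⊥-elim (outside-neighbours-unordered x<y out out′ xw yw xw′ yw′ w<w′)
  ... | tri≈ _ w≡w′ _ = pos-injective w≡w′
  ... | tri> _ _ w′<w = ⊥-elim (outside-neighbours-unordered x<y out′ out xw′ yw′ xw yw w′<w)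

  Frame : Fin m → Fin m → Fin m → Set
  Frame x y p = Triangle H p x y × pos x < pos y × Outside x y p

  apex-inside : ∀ {x y p w} → Frame x y p → Apex H x y p w → Inside x y w
  apex-inside ((px , py , _) , x<y , out-p) (xw , yw , w≢p)
    with inside-or-outside (edge-≢ H xw ∘ ≡-sym) (edge-≢ H yw ∘ ≡-sym)
  ... | inj₁ in-w  = in-w
  ... | inj₂ out-w =
    contradiction (common-neighbours-outside x<y out-w out-p xw yw (edge-sym H px) (edge-sym H py)) w≢p

  apex-unique : ∀ {x y p w w′} → Frame x y p → Apex H x y p w → Apex H x y p w′ → w ≡ w′
  apex-unique frame a@(xw , yw , _) a′@(xw′ , yw′ , _) =
    common-neighbours-inside (apex-inside frame a) (apex-inside frame a′) xw yw xw′ yw′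

  frame-right : ∀ {x y p w} → Frame x y p → Apex H x y p w → Frame w y x
  frame-right frame@((_ , _ , xy) , _ , _) a@(xw , yw , _) =
    let (x<w , w<y) = apex-inside frame a in (xw , xy , edge-sym H yw) , w<y , inj₁ x<w

  frame-left : ∀ {x y p w} → Frame x y p → Apex H x y p w → Frame x w y
  frame-left frame@((_ , _ , xy) , _ , _) a@(xw , yw , _) =
    let (x<w , w<y) = apex-inside frame a in (edge-sym H xy , yw , xw) , x<w , inj₂ w<y

  strip-inside : ∀ {j x y p z} (s : Vec Bool j) → Frame x y p → Strip H x y p s z → Inside x y z
  strip-inside []          frame a              = apex-inside frame a
  strip-inside (true ∷ s)  frame (w , a , rest) =
    let (x<w , _) = apex-inside frame a
        (w<z , z<y) = strip-inside s (frame-right frame a) rest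
    in <-trans x<w w<z , z<y
  strip-inside (false ∷ s) frame (w , a , rest) =
    let (_ , w<y) = apex-inside frame a
        (x<z , z<w) = strip-inside s (frame-left frame a) rest
    in x<z , <-trans z<w w<y

  halves-disjoint : ∀ {x y w z} → Inside w y z → Inside x w z → ⊥
  halves-disjoint (w<z , _) (_ , z<w) = <-asym w<z z<w

  strip-unique : ∀ {j x y p z} (s t : Vec Bool j) → Frame x y p →
    Strip H x y p s z → Strip H x y p t z → s ≡ t
  strip-unique []          []          _     _              _                = refl
  strip-unique (true ∷ s)  (true ∷ t)  frame (w , a , rest) (_ , a′ , rest′)
    with refl ← apex-unique frame a a′ = cong (true ∷_) (strip-unique s t (frame-right frame a) rest rest′)
  strip-unique (false ∷ s) (false ∷ t) frame (w , a , rest) (_ , a′ , rest′)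
    with refl ← apex-unique frame a a′ = cong (false ∷_) (strip-unique s t (frame-left frame a) rest rest′)
  strip-unique (true ∷ s)  (false ∷ t) frame (w , a , rest) (_ , a′ , rest′)
    with refl ← apex-unique frame a a′ =
    ⊥-elim (halves-disjoint (strip-inside s (frame-right frame a) rest) (strip-inside t (frame-left frame a) rest′))
  strip-unique (false ∷ s) (true ∷ t)  frame (w , a , rest) (_ , a′ , rest′)
    with refl ← apex-unique frame a a′ =
    ⊥-elim (halves-disjoint (strip-inside t (frame-right frame a) rest′) (strip-inside s (frame-left frame a) rest))

  module Origin (A : Fin m) (A-at-0 : pos A ≡ 0) where

    neighbour-after : ∀ {v} → Edge H A v → pos A < pos v
    neighbour-after {v} Av = subst (_< pos v) (≡-sym A-at-0) (n≢0⇒n>0 v-not-at-0)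
      where
      v-not-at-0 : pos v ≢ 0
      v-not-at-0 v-at-0 = edge-≢ H Av (pos-injective (trans A-at-0 (≡-sym v-at-0)))

    oriented : ∀ {x y} → Triangle H A x y → Frame x y A ⊎ Frame y x A
    oriented {x} {y} t@(Ax , Ay , xy) with <-cmp (pos x) (pos y)
    ... | tri< x<y _ _ = inj₁ (t , x<y , inj₁ (neighbour-after Ax))
    ... | tri≈ _ x≡y _ = contradiction (pos-injective x≡y) (edge-≢ H xy)
    ... | tri> _ _ y<x = inj₂ (triangle-swap H t , y<x , inj₁ (neighbour-after Ay))

    strip-between : ∀ {j x y z} (s : Vec Bool j) → Triangle H A x y → Strip H x y A s z → Between x y z
    strip-between s t st with oriented t
    ... | inj₁ frame = inj₁ (strip-inside s frame st)
    ... | inj₂ frame = inj₂ (strip-inside (map not s) frame (strip-swap H s st))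

    strip-code-unique : ∀ {j x y z} (s t : Vec Bool j) → Triangle H A x y →
      Strip H x y A s z → Strip H x y A t z → s ≡ t
    strip-code-unique s t tr st st′ with oriented tr
    ... | inj₁ frame = strip-unique s t frame st st′
    ... | inj₂ frame = map-injective not-injective
      (strip-unique (map not s) (map not t) frame (strip-swap H s st) (strip-swap H t st′))

    no-neighbour-inside : ∀ {x y q} → Triangle H A x y → Edge H A q → Inside x y q → ⊥
    no-neighbour-inside (Ax , _ , xy) Aq in-q = edge-across xy (edge-sym H Aq) in-q (inj₁ (neighbour-after Ax))

    chord-unique : ∀ {x y x′ y′ z} → Triangle H A x y → Triangle H A x′ y′ →
      Inside x y z → Inside x′ y′ z → x ≡ x′ × y ≡ y′
    chord-unique {x} {y} {x′} {y′} t@(Ax , Ay , _) t′@(Ax′ , Ay′ , _) (x<z , z<y) (x′<z , z<y′) =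
      lower , upper
      where
      lower : x ≡ x′
      lower with <-cmp (pos x) (pos x′)
      ... | tri< x<x′ _ _ = ⊥-elim (no-neighbour-inside t Ax′ (x<x′ , <-trans x′<z z<y))
      ... | tri≈ _ x≡x′ _ = pos-injective x≡x′
      ... | tri> _ _ x′<x = ⊥-elim (no-neighbour-inside t′ Ax (x′<x , <-trans x<z z<y′))
      upper : y ≡ y′
      upper with <-cmp (pos y) (pos y′)
      ... | tri< y<y′ _ _ = ⊥-elim (no-neighbour-inside t′ Ay (<-trans x′<z z<y , y<y′))
      ... | tri≈ _ y≡y′ _ = pos-injective y≡y′
      ... | tri> _ _ y′<y = ⊥-elim (no-neighbour-inside t Ay′ (<-trans x<z z<y′ , y′<y))

    chord-unique-unordered : ∀ {x y x′ y′ z} → Triangle H A x y → Triangle H A x′ y′ →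
      Between x y z → Between x′ y′ z → (x ≡ x′ × y ≡ y′) ⊎ (x ≡ y′ × y ≡ x′)
    chord-unique-unordered t t′ (inj₁ i) (inj₁ i′) = inj₁ (chord-unique t t′ i i′)
    chord-unique-unordered t t′ (inj₁ i) (inj₂ i′) = inj₂ (chord-unique t (triangle-swap H t′) i i′)
    chord-unique-unordered t t′ (inj₂ i) (inj₁ i′) =
      inj₂ (swap (chord-unique (triangle-swap H t) t′ i i′))
    chord-unique-unordered t t′ (inj₂ i) (inj₂ i′) =
      inj₁ (swap (chord-unique (triangle-swap H t) (triangle-swap H t′) i i′))

    -- The leading bit false records which end of the chord is W, so that
    -- reading the strip from B instead of W cannot reproduce the same code.
    hanging-strip-code-unique : ∀ {k W B W′ B′ Z} (d d′ : Vec Bool k) →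
      Triangle H A W B → Triangle H A W′ B′ →
      Strip H W B A (false ∷ d) Z → Strip H W′ B′ A (false ∷ d′) Z → d ≡ d′
    hanging-strip-code-unique d d′ t t′ st st′
      with chord-unique-unordered t t′ (strip-between (false ∷ d) t st) (strip-between (false ∷ d′) t′ st′)
    ... | inj₁ (refl , refl) = ∷-injectiveʳ (strip-code-unique (false ∷ d) (false ∷ d′) t st st′)
    ... | inj₂ (refl , refl) =
      contradiction
        (∷-injectiveˡ (strip-code-unique (false ∷ d) (true ∷ map not d′) t st
                                         (strip-swap H (false ∷ d′) st′)))
        λ ()

Link : ℕ → List (ℕ × ℕ) → ℕ → ℕ → Set
Link N cs u v = u < v × v ≤ N × (v ≡ suc u ⊎ (u ≡ 0 × v ≡ N) ⊎ (u , v) ∈ cs)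

link? : ∀ N cs u v → Dec (Link N cs u v)
link? N cs u v = u <? v ×-dec v ≤? N ×-dec (v ≟ suc u ⊎-dec u ≟ 0 ×-dec v ≟ N ⊎-dec (u , v) ∈? cs)

link-irrefl : ∀ {N cs u} → ¬ Link N cs u u
link-irrefl (u<u , _) = <-irrefl refl u<u

adjacent? : ∀ N cs (u v : Fin (suc N)) → Dec (Link N cs (toℕ u) (toℕ v) ⊎ Link N cs (toℕ v) (toℕ u))
adjacent? N cs u v = link? N cs (toℕ u) (toℕ v) ⊎-dec link? N cs (toℕ v) (toℕ u)

polygon : (N : ℕ) → List (ℕ × ℕ) → Graph (suc N)
polygon N cs = record
  { adj    = λ u v → does (adjacent? N cs u v)
  ; sym    = λ u v → ∨-comm (does (link? N cs (toℕ u) (toℕ v))) (does (link? N cs (toℕ v) (toℕ u)))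
  ; irrefl = λ v → dec-false (adjacent? N cs v v) [ link-irrefl , link-irrefl ]
  }

vertex : ∀ {N} → ℕ → Fin (suc N)
vertex {N} u = fromℕ< (s≤s (m⊓n≤n u N))

NonCrossingChords : List (ℕ × ℕ) → Set
NonCrossingChords cs = ∀ {a b c d} → (a , b) ∈ cs → (c , d) ∈ cs → a < c → c < b → b < d → ⊥

shrink : Bool → ℕ × ℕ → ℕ × ℕ
shrink true  (lo , hi) = suc lo , hi
shrink false (lo , hi) = lo , pred hi

chords : ∀ {j} → ℕ × ℕ → Vec Bool j → List (ℕ × ℕ)
chords c []      = c ∷ []
chords c (b ∷ s) = c ∷ chords (shrink b c) s

_⊑_ : ℕ × ℕ → ℕ × ℕ → Set
(a , b) ⊑ (c , d) = c ≤ a × b ≤ d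

⊑-refl : ∀ {c} → c ⊑ c
⊑-refl = ≤-refl , ≤-refl

⊑-trans : ∀ {x y z} → x ⊑ y → y ⊑ z → x ⊑ z
⊑-trans (c≤a , b≤d) (e≤c , d≤f) = ≤-trans e≤c c≤a , ≤-trans b≤d d≤f

shrink-⊑ : ∀ b c → shrink b c ⊑ c
shrink-⊑ true  (lo , hi) = n≤1+n lo , ≤-refl
shrink-⊑ false (lo , hi) = ≤-refl , pred[n]≤n

chords-head : ∀ {j} c (s : Vec Bool j) → c ∈ chords c s
chords-head c []      = here refl
chords-head c (_ ∷ _) = here refl

chords-⊑ : ∀ {j c x} (s : Vec Bool j) → x ∈ chords c s → x ⊑ c
chords-⊑         []      (here refl) = ⊑-refl
chords-⊑         (b ∷ s) (here refl) = ⊑-refl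
chords-⊑ {c = c} (b ∷ s) (there x∈) = ⊑-trans (chords-⊑ s x∈) (shrink-⊑ b c)

chords-nested : ∀ {j c x y} (s : Vec Bool j) → x ∈ chords c s → y ∈ chords c s → x ⊑ y ⊎ y ⊑ x
chords-nested []      (here refl) (here refl) = inj₁ ⊑-refl
chords-nested (b ∷ s) (here refl) y∈          = inj₂ (chords-⊑ (b ∷ s) y∈)
chords-nested (b ∷ s) (there x∈)  (here refl) = inj₁ (chords-⊑ (b ∷ s) (there x∈))
chords-nested (b ∷ s) (there x∈)  (there y∈)  = chords-nested s x∈ y∈

chords-nonCrossing : ∀ {j c} (s : Vec Bool j) → NonCrossingChords (chords c s)
chords-nonCrossing s ab cd a<c _ b<d with chords-nested s ab cd
... | inj₁ (c≤a , _) = <⇒≱ a<c c≤a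
... | inj₂ (_ , d≤b) = <⇒≱ b<d d≤b

between-≢ : ∀ {lo w hi p} → lo < w → w < hi → p < lo ⊎ hi < p → w ≢ p
between-≢ lo<w _    (inj₁ p<lo) refl = <-asym p<lo lo<w
between-≢ _    w<hi (inj₂ hi<p) refl = <-asym hi<p w<hi

module Polygon (N : ℕ) (cs : List (ℕ × ℕ)) where

  link-nonCrossing : NonCrossingChords cs → ∀ {a b c d} → Link N cs a b → Link N cs c d →
    a < c → c < b → b < d → ⊥
  link-nonCrossing _  (_ , _ , inj₁ refl) _ a<c c<b _ = <⇒≱ a<c (m<1+n⇒m≤n c<b)
  link-nonCrossing _  _ (_ , _ , inj₁ refl) _ c<b b<d = <⇒≱ c<b (m<1+n⇒m≤n b<d)
  link-nonCrossing _  (_ , _ , inj₂ (inj₁ (refl , refl))) (_ , d≤N , _) _ _ b<d = <⇒≱ b<d d≤N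
  link-nonCrossing _  _ (_ , _ , inj₂ (inj₁ (refl , refl))) a<c _ _ = n≮0 a<c
  link-nonCrossing nc (_ , _ , inj₂ (inj₂ ab)) (_ , _ , inj₂ (inj₂ cd)) = nc ab cd

  edge⇒link : ∀ {u v} → toℕ u < toℕ v → Edge (polygon N cs) u v → Link N cs (toℕ u) (toℕ v)
  edge⇒link {u} {v} u<v e with does-true (adjacent? N cs u v) e
  ... | inj₁ l         = l
  ... | inj₂ (v<u , _) = contradiction v<u (<-asym u<v)

  polygon-outerplanar : NonCrossingChords cs → Outerplanar (polygon N cs)
  polygon-outerplanar nc = ↔-id _ , λ a b c d a<c c<b b<d ab cd →
    link-nonCrossing nc (edge⇒link (<-trans a<c c<b) ab) (edge⇒link (<-trans c<b b<d) cd) a<c c<b b<d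

  toℕ-vertex : ∀ {u} → u ≤ N → toℕ (vertex {N} u) ≡ u
  toℕ-vertex {u} u≤N = trans (toℕ-fromℕ< _) (m≤n⇒m⊓n≡m u≤N)

  vertex-≢ : ∀ {u v} → u ≤ N → v ≤ N → u ≢ v → vertex {N} u ≢ vertex v
  vertex-≢ u≤N v≤N u≢v e =
    u≢v (trans (≡-sym (toℕ-vertex u≤N)) (trans (cong toℕ e) (toℕ-vertex v≤N)))

  link⇒edge : ∀ {u v} → Link N cs u v → Edge (polygon N cs) (vertex u) (vertex v)
  link⇒edge {u} {v} l@(u<v , v≤N , _) = dec-true (adjacent? N cs (vertex u) (vertex v)) (inj₁ l′)
    where
    l′ : Link N cs (toℕ (vertex {N} u)) (toℕ (vertex {N} v))
    l′ = subst₂ (Link N cs) (≡-sym (toℕ-vertex (≤-trans (<⇒≤ u<v) v≤N))) (≡-sym (toℕ-vertex v≤N))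
                l

  side-edge : ∀ {u} → suc u ≤ N → Edge (polygon N cs) (vertex u) (vertex (suc u))
  side-edge u<N = link⇒edge (n<1+n _ , u<N , inj₁ refl)

  chord-edge : ∀ {u v} → (u , v) ∈ cs → u < v → v ≤ N → Edge (polygon N cs) (vertex u) (vertex v)
  chord-edge uv u<v v≤N = link⇒edge (u<v , v≤N , inj₂ (inj₂ uv))

  -- A code of length j needs the j + 1 vertices strictly between lo and hi as apices.
  polygon-strip : ∀ {j} lo hi p (s : Vec Bool j) → hi ≡ suc (suc (j + lo)) → hi ≤ N → p ≤ N →
    p < lo ⊎ hi < p → chords (lo , hi) s ⊆ cs →
    Σ[ z ∈ Fin (suc N) ] Strip (polygon N cs) (vertex lo) (vertex hi) (vertex p) s z
  polygon-strip lo _ p [] refl hi≤N p≤N out _ =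
    vertex (suc lo) ,
    side-edge w≤N , edge-sym (polygon N cs) {vertex (suc lo)} (side-edge hi≤N) ,
    vertex-≢ w≤N p≤N (between-≢ (n<1+n lo) (n<1+n (suc lo)) out)
    where
    w≤N : suc lo ≤ N
    w≤N = ≤-trans (n≤1+n _) hi≤N
  polygon-strip {suc j} lo hi p (true ∷ s) refl hi≤N p≤N out sub =
    let (z , rest) = polygon-strip (suc lo) hi lo s (cong (2 +_) (≡-sym (+-suc j lo))) hi≤N lo≤N
                       (inj₁ (n<1+n lo)) (sub ∘ there)
    in z , vertex (suc lo) , apex , rest
    where
    w<hi : suc lo < hi
    w<hi = s≤s (s≤s (m≤n⇒m≤1+n (m≤n+m lo j)))
    w≤N : suc lo ≤ N
    w≤N = ≤-trans (<⇒≤ w<hi) hi≤N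
    lo≤N : lo ≤ N
    lo≤N = ≤-trans (n≤1+n lo) w≤N
    apex : Apex (polygon N cs) (vertex lo) (vertex hi) (vertex p) (vertex (suc lo))
    apex = side-edge w≤N ,
           edge-sym (polygon N cs) {vertex (suc lo)}
             (chord-edge (sub (there (chords-head (suc lo , hi) s))) w<hi hi≤N) ,
           vertex-≢ w≤N p≤N (between-≢ (n<1+n lo) w<hi out)
  polygon-strip {suc j} lo (suc h) p (false ∷ s) refl hi≤N p≤N out sub =
    let (z , rest) = polygon-strip lo h (suc h) s refl h≤N hi≤N (inj₂ (n<1+n h)) (sub ∘ there)
    in z , vertex h , apex , rest
    where
    lo<h : lo < h
    lo<h = s≤s (m≤n⇒m≤1+n (m≤n+m lo j))
    h≤N : h ≤ N
    h≤N = ≤-trans (n≤1+n h) hi≤N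
    apex : Apex (polygon N cs) (vertex lo) (vertex (suc h)) (vertex p) (vertex h)
    apex = chord-edge (sub (there (chords-head (lo , h) s))) lo<h h≤N ,
           edge-sym (polygon N cs) {vertex h} (side-edge hi≤N) ,
           vertex-≢ h≤N p≤N (between-≢ lo<h (n<1+n h) out)

zigzag : ∀ {k} → Vec Bool k → Graph (5 + k)
zigzag {k} d = polygon (4 + k) (chords (1 , 4 + k) (false ∷ d))

zigzag-outerplanar : ∀ {k} (d : Vec Bool k) → Outerplanar (zigzag d)
zigzag-outerplanar {k} d = Polygon.polygon-outerplanar (4 + k) _ (chords-nonCrossing (false ∷ d))

zigzag-triangle : ∀ {k} (d : Vec Bool k) → Triangle (zigzag d) (vertex 0) (vertex 1) (vertex (4 + k))
zigzag-triangle {k} d =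
  side-edge (s≤s z≤n) ,
  link⇒edge (s≤s z≤n , ≤-refl , inj₂ (inj₁ (refl , refl))) ,
  chord-edge (here refl) (s≤s (s≤s z≤n)) ≤-refl
  where open Polygon (4 + k) (chords (1 , 4 + k) (false ∷ d))

zigzag-strip : ∀ {k} (d : Vec Bool k) →
  Σ[ z ∈ Fin (5 + k) ] Strip (zigzag d) (vertex 1) (vertex (4 + k)) (vertex 0) (false ∷ d) z
zigzag-strip {k} d =
  polygon-strip 1 (4 + k) 0 (false ∷ d) (cong (3 +_) (+-comm 1 k)) ≤-refl z≤n (inj₁ (s≤s z≤n)) ⊆-refl
  where open Polygon (4 + k) (chords (1 , 4 + k) (false ∷ d))

zigzag-end : ∀ {k} → Vec Bool k → Fin (5 + k)
zigzag-end d = proj₁ (zigzag-strip d)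

module _ {m : ℕ} (H : Graph m) (outer : Outerplanar H) where

  outerplanar-hanging-strip-code-unique : ∀ {k A W B Z A′ W′ B′ Z′} (d d′ : Vec Bool k) →
    Triangle H A W B → Strip H W B A (false ∷ d) Z →
    Triangle H A′ W′ B′ → Strip H W′ B′ A′ (false ∷ d′) Z′ →
    A ≡ A′ → Z ≡ Z′ → d ≡ d′
  outerplanar-hanging-strip-code-unique {A = A} d d′ t st t′ st′ refl refl =
    let (D , A-at-0) = rotate-to-zero (outerplanar-drawing outer) A
    in Geometry.Origin.hanging-strip-code-unique D A A-at-0 d d′ t t′ st st′

  zigzag-image : ∀ {k} {d : Vec Bool k} (e : zigzag d ⊆G H) → let f = proj₁ e in
    Triangle H (f (vertex 0)) (f (vertex 1)) (f (vertex (4 + k))) ×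
    Strip H (f (vertex 1)) (f (vertex (4 + k))) (f (vertex 0)) (false ∷ d) (f (zigzag-end d))
  zigzag-image {d = d} e =
    triangle-map {G = zigzag d} {H} e (zigzag-triangle d) ,
    strip-map {G = zigzag d} {H} e (false ∷ d) (proj₂ (zigzag-strip d))

  zigzag-anchors-determine-code : ∀ {k} (d d′ : Vec Bool k) (e : zigzag d ⊆G H) (e′ : zigzag d′ ⊆G H) →
    proj₁ e (vertex 0) ≡ proj₁ e′ (vertex 0) →
    proj₁ e (zigzag-end d) ≡ proj₁ e′ (zigzag-end d′) → d ≡ d′
  zigzag-anchors-determine-code d d′ e e′ =
    let (t , st) = zigzag-image e
        (t′ , st′) = zigzag-image e′
    in outerplanar-hanging-strip-code-unique d d′ t st t′ st′

bits : ∀ k → Fin (2 ^ k) → Vec Bool k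
bits zero    _ = []
bits (suc k) i = Inverse.to 2↔Bool (quotient {2} (2 ^ k) i) ∷ bits k (remainder {2} (2 ^ k) i)

bits-injective : ∀ k → Injective _≡_ _≡_ (bits k)
bits-injective zero    {zero} {zero} _ = refl
bits-injective (suc k) {i}    {j}    e = begin
  i                                                            ≡⟨ combine-remQuot {2} (2 ^ k) i ⟨
  combine (quotient {2} (2 ^ k) i) (remainder {2} (2 ^ k) i)  ≡⟨ cong₂ combine quotient≡ remainder≡ ⟩
  combine (quotient {2} (2 ^ k) j) (remainder {2} (2 ^ k) j)  ≡⟨ combine-remQuot {2} (2 ^ k) j ⟩
  j                                                            ∎
  where
  open ≡-Reasoning
  quotient≡ : quotient {2} (2 ^ k) i ≡ quotient {2} (2 ^ k) j
  quotient≡ = Injection.injective (↔⇒↣ 2↔Bool) (∷-injectiveˡ e)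
  remainder≡ : remainder {2} (2 ^ k) i ≡ remainder {2} (2 ^ k) j
  remainder≡ = bits-injective k (∷-injectiveʳ e)

zigzag-bound : ∀ k {m} (H : Graph m) → Outerplanar H →
  (∀ (G : Graph (5 + k)) → Outerplanar G → G ⊆G H) → 2 ^ k ≤ m * m
zigzag-bound k {m} H outer universal = injective⇒≤ {f = anchors} anchors-injective
  where
  embedding : (i : Fin (2 ^ k)) → zigzag (bits k i) ⊆G H
  embedding i = universal (zigzag (bits k i)) (zigzag-outerplanar (bits k i))

  origin end : Fin (2 ^ k) → Fin m
  origin i = proj₁ (embedding i) (vertex 0)
  end    i = proj₁ (embedding i) (zigzag-end (bits k i))

  anchors : Fin (2 ^ k) → Fin (m * m)
  anchors i = combine (origin i) (end i)

  anchors-injective : Injective _≡_ _≡_ anchors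
  anchors-injective {i} {j} e =
    let (origin≡ , end≡) = combine-injective (origin i) (end i) (origin j) (end j) e
    in bits-injective k
         (zigzag-anchors-determine-code H outer (bits k i) (bits k j) (embedding i) (embedding j) origin≡ end≡)

edgeless : ∀ n → Graph n
edgeless n = record { adj = λ _ _ → false ; sym = λ _ _ → refl ; irrefl = λ _ → refl }

edgeless-outerplanar : ∀ n → Outerplanar (edgeless n)
edgeless-outerplanar n = ↔-id _ , λ _ _ _ _ _ _ _ ()

universal-size : ∀ {n m} (H : Graph m) → (∀ (G : Graph n) → Outerplanar G → G ⊆G H) → n ≤ m
universal-size {n} H universal =
  let (f , f-injective , _) = universal (edgeless n) (edgeless-outerplanar n) in injective⇒≤ {f = f} f-injective

square-positive : ∀ {n m} → suc n ≤ m → 1 ≤ m * m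
square-positive (s≤s _) = s≤s z≤n

theorem11 : ∀ (n : ℕ) → 1 ≤ n →
    ∀ (m : ℕ) (H : Graph m) → Outerplanar H →
    (∀ (G : Graph n) → Outerplanar G → G ⊆G H) →
    2 ^ (n ∸ 5) ≤ m * m
theorem11 (suc (suc (suc (suc (suc k))))) _ _ H outer universal = zigzag-bound k H outer universal
theorem11 1 _ _ H _ universal = square-positive (universal-size H universal)
theorem11 2 _ _ H _ universal = square-positive (universal-size H universal)
theorem11 3 _ _ H _ universal = square-positive (universal-size H universal)
theorem11 4 _ _ H _ universal = square-positive (universal-size H universal)
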